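{- Let $\models_{\mathsf{DF/TT}}$ be the consequence relation of the logic $\mathsf{DF/TT}$ described in the context, and let $A\supset B$ abbreviate $\neg(A\wedge\neg B)$. Then for all formulae $A,B$: (1) $A\supset B\models_{\mathsf{DF/TT}} A\to B$ and $A\to B\models_{\mathsf{DF/TT}} A\supset B$; (2) $\models_{\mathsf{DF/TT}} (A\supset B)\supset\!\subset(A\to B)$; (3) $\models_{\mathsf{DF/TT}} (A\supset B)\leftrightarrow(A\to B)$.
   Context: Formulae are built from propositional variables with $\neg,\wedge,\vee,\to$. A $\mathsf{DF}$-evaluation is a map $v$ from formulae to $\{0,\tfrac12,1\}$ satisfying the Strong Kleene clauses $v(\neg A)=1-v(A)$, $v(A\wedge B)=\min(v(A),v(B))$, $v(A\vee B)=\max(v(A),v(B))$, and the de Finetti clause for the conditional: $v(A\to B)=v(B)$ if $v(A)=1$, and $v(A\to B)=\tfrac12$ if $v(A)\in\{0,\tfrac12\}$. Consequence is tolerant-to-tolerant: $A\models_{\mathsf{DF/TT}}C$ iff for every $\mathsf{DF}$-evaluation $v$, $v(A)\in\{\tfrac12,1\}$ implies $v(C)\in\{\tfrac12,1\}$; and $\models_{\mathsf{DF/TT}}C$ iff $v(C)\in\{\tfrac12,1\}$ for every $\mathsf{DF}$-evaluation $v$. The material conditional $A\supset B$ is $\neg(A\wedge\neg B)$ (equivalently $\neg A\vee B$); the material biconditional $A\supset\!\subset B$ is $(A\supset B)\wedge(B\supset A)$ and the indicative biconditional $A\leftrightarrow B$ is $(A\to B)\wedge(B\to A)$. -}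

module Defs where

open import Data.Nat using (ℕ)
open import Data.Product using (_×_)
open import Relation.Binary.PropositionalEquality using (_≡_)

data Formula : Set where
  var  : ℕ → Formula
  ¬'_  : Formula → Formula
  _∧'_ : Formula → Formula → Formula
  _∨'_ : Formula → Formula → Formula
  _⇒_  : Formula → Formula → Formula   -- the indicative (de Finetti) conditional →

infixr 4 _⇒_
infixr 5 _∨'_
infixr 6 _∧'_
infix 7 ¬'_

-- Truth values 0, 1/2, 1
data V : Set where
  v0 vh v1 : V

neg : V → V
neg v0 = v1
neg vh = vh
neg v1 = v0

min : V → V → V
min v0 _  = v0
min vh v0 = v0
min vh _  = vh
min v1 y  = y

max : V → V → V
max v0 y  = y
max vh v1 = v1
max vh _  = vh
max v1 _  = v1

dfCond : V → V → V
dfCond v1 y = y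
dfCond _  _ = vh

record IsDFEval (v : Formula → V) : Set where
  field
    ev-neg  : ∀ A → v (¬' A) ≡ neg (v A)
    ev-and  : ∀ A B → v (A ∧' B) ≡ min (v A) (v B)
    ev-or   : ∀ A B → v (A ∨' B) ≡ max (v A) (v B)
    ev-cond : ∀ A B → v (A ⇒ B) ≡ dfCond (v A) (v B)

data Tol : V → Set where
  tol-h : Tol vh
  tol-1 : Tol v1

-- Tolerant-to-tolerant consequence
_⊨TT_ : Formula → Formula → Set
A ⊨TT C = (v : Formula → V) → IsDFEval v → Tol (v A) → Tol (v C)

⊨TT_ : Formula → Set
⊨TT C = (v : Formula → V) → IsDFEval v → Tol (v C)

_⊃_ : Formula → Formula → Formula
A ⊃ B = ¬' (A ∧' ¬' B)

_⊃⊂_ : Formula → Formula → Formula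
A ⊃⊂ B = (A ⊃ B) ∧' (B ⊃ A)

_⇔'_ : Formula → Formula → Formula
A ⇔' B = (A ⇒ B) ∧' (B ⇒ A)

infixr 4 _⊃_
infix 3 _⊃⊂_ _⇔'_
infix 2 _⊨TT_ ⊨TT_

module Submission where

-- Under the Strong Kleene / de Finetti tables, both conditionals
-- are tolerated (valued 1/2 or 1) in exactly the same situations: unless the
-- antecedent is 1 and the consequent is 0.  We call the condition "if x = 1
-- then y is tolerated" the guard of x and y, and show that the material truth
-- function  mat x y = neg (min x (neg y))  and  dfCond x y  are tolerated
-- precisely when the guard holds.  This gives (1) at once.
-- For (2) and (3) we prove two general facts about DF/TT:
--   * a deduction theorem for both conditionals: if A ⊨TT C then ⊨TT A ⊃ C
--     and ⊨TT A ⇒ C (tolerance of A forces tolerance of C, so the guard holds);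
--   * validity is closed under conjunction.
-- The biconditionals are conjunctions of conditionals between the two sides,
-- so (2) and (3) follow from (1) by these two facts.

open import Defs
open import Data.Product using (_×_; _,_)
open import Relation.Binary.PropositionalEquality using (_≡_; refl; subst; sym)

mat : V → V → V
mat x y = neg (min x (neg y))

Guard : V → V → Set
Guard x y = x ≡ v1 → Tol y

mat-guard : ∀ x y → Tol (mat x y) → Guard x y
mat-guard v1 vh _ refl = tol-h
mat-guard v1 v1 _ refl = tol-1
mat-guard v1 v0 () refl

guard-mat : ∀ x y → Guard x y → Tol (mat x y)
guard-mat v0 y  _ = tol-1
guard-mat vh v0 _ = tol-h
guard-mat vh vh _ = tol-h
guard-mat vh v1 _ = tol-1
guard-mat v1 y  g with g refl
... | tol-h = tol-h
... | tol-1 = tol-1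

cond-guard : ∀ x y → Tol (dfCond x y) → Guard x y
cond-guard v1 y t refl = t

guard-cond : ∀ x y → Guard x y → Tol (dfCond x y)
guard-cond v0 y _ = tol-h
guard-cond vh y _ = tol-h
guard-cond v1 y g = g refl

preserve-guard : ∀ x y → (Tol x → Tol y) → Guard x y
preserve-guard x y f refl = f tol-1

min-tol : ∀ {x y} → Tol x → Tol y → Tol (min x y)
min-tol tol-h tol-h = tol-h
min-tol tol-h tol-1 = tol-h
min-tol tol-1 t     = t

module _ {v : Formula → V} (e : IsDFEval v) where
  open IsDFEval e

  ⊃-value : ∀ A B → v (A ⊃ B) ≡ mat (v A) (v B)
  ⊃-value A B rewrite ev-neg (A ∧' ¬' B) | ev-and A (¬' B) | ev-neg B = refl

  ⊃-tol-guard : ∀ A B → Tol (v (A ⊃ B)) → Guard (v A) (v B)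
  ⊃-tol-guard A B t = mat-guard (v A) (v B) (subst Tol (⊃-value A B) t)

  guard-⊃-tol : ∀ A B → Guard (v A) (v B) → Tol (v (A ⊃ B))
  guard-⊃-tol A B g = subst Tol (sym (⊃-value A B)) (guard-mat (v A) (v B) g)

  ⇒-tol-guard : ∀ A B → Tol (v (A ⇒ B)) → Guard (v A) (v B)
  ⇒-tol-guard A B t = cond-guard (v A) (v B) (subst Tol (ev-cond A B) t)

  guard-⇒-tol : ∀ A B → Guard (v A) (v B) → Tol (v (A ⇒ B))
  guard-⇒-tol A B g = subst Tol (sym (ev-cond A B)) (guard-cond (v A) (v B) g)

⊃-entails-⇒ : ∀ A B → A ⊃ B ⊨TT A ⇒ B
⊃-entails-⇒ A B v e t = guard-⇒-tol e A B (⊃-tol-guard e A B t)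

⇒-entails-⊃ : ∀ A B → A ⇒ B ⊨TT A ⊃ B
⇒-entails-⊃ A B v e t = guard-⊃-tol e A B (⇒-tol-guard e A B t)

deduction-⊃ : ∀ {A C} → A ⊨TT C → ⊨TT A ⊃ C
deduction-⊃ {A} {C} A⊨C v e = guard-⊃-tol e A C (preserve-guard (v A) (v C) (A⊨C v e))

deduction-⇒ : ∀ {A C} → A ⊨TT C → ⊨TT A ⇒ C
deduction-⇒ {A} {C} A⊨C v e = guard-⇒-tol e A C (preserve-guard (v A) (v C) (A⊨C v e))

valid-∧ : ∀ {A B} → ⊨TT A → ⊨TT B → ⊨TT A ∧' B
valid-∧ {A} {B} ⊨A ⊨B v e =
  subst Tol (sym (IsDFEval.ev-and e A B)) (min-tol (⊨A v e) (⊨B v e))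

mainTheorem1 : (A B : Formula) →
    (((A ⊃ B) ⊨TT (A ⇒ B)) × ((A ⇒ B) ⊨TT (A ⊃ B)))
    × (⊨TT ((A ⊃ B) ⊃⊂ (A ⇒ B)))
    × (⊨TT ((A ⊃ B) ⇔' (A ⇒ B)))
mainTheorem1 A B =
    (forward , backward)
  , valid-∧ (deduction-⊃ forward) (deduction-⊃ backward)
  , valid-∧ (deduction-⇒ forward) (deduction-⇒ backward)
  where
  forward : A ⊃ B ⊨TT A ⇒ B
  forward = ⊃-entails-⇒ A B

  backward : A ⇒ B ⊨TT A ⊃ B
  backward = ⇒-entails-⊃ A B
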